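{- Let $q$ be a prime power with $p = \mathrm{char}(\mathbb F_q)$, let $k \ge 2$, $n$, $h$ be integers, let $F$ be a monic polynomial of degree $n$ in $\mathbb F_q[x]$, and let $r$ be the least positive integer such that $p \nmid \binom{k}{r}$. If $r = k$ and $d$ is an integer with $h < d$ and $(n-h)/k \le d \le n/k$, then \[ |\mathcal S_q(d)| \le q^{h/k + 1}. \]
   Context: $\mathbb F_q$ is the finite field with $q$ elements and $\mathcal M_q$ the set of monic polynomials in $\mathbb F_q[x]$; $\mathcal M_q(d)$ is the set of monic polynomials of degree $d$. For $F \in \mathbb F_q[x]$ and an integer $h$, $\mathcal I_q(F,h) = \{ Q \in \mathbb F_q[x] : \deg(F-Q) \le h\}$. With $F, h, k$ fixed, $\mathcal S_q(d) = \{ G \in \mathcal M_q(d) : G^k A \in \mathcal I_q(F,h) \text{ for some } A \in \mathcal M_q\}$. -}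

module Defs where

open import Level using (0ℓ)
open import Data.Nat as ℕ using (ℕ; zero; suc; _≤_; _<_)
open import Data.Nat.Divisibility using (_∣_)
open import Data.Nat.Primality using (Prime)
open import Data.Nat.Combinatorics using (_C_)
open import Data.Integer as ℤ using (ℤ; +_; -[1+_])
open import Data.List using (List; []; _∷_; map; length)
open import Data.List.Membership.Propositional using (_∈_)
open import Data.List.Relation.Unary.Unique.Propositional using (Unique)
open import Data.Vec using (Vec; toList)
open import Data.Product using (Σ; ∃; _×_)
open import Relation.Binary.PropositionalEquality using (_≡_; _≢_)
open import Relation.Nullary using (¬_)
open import Algebra.Structures using (IsCommutativeRing)
open import Algebra.Core using (Op₁; Op₂)

record IsField {A : Set} (_+_ _*_ : Op₂ A) (-_ : Op₁ A) (0# 1# : A) : Set where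
  field
    isCommutativeRing : IsCommutativeRing _≡_ _+_ _*_ -_ 0# 1#
    0≢1               : 0# ≢ 1#
    inverse           : ∀ x → x ≢ 0# → Σ A (λ y → (x * y) ≡ 1#)

record FiniteField (q : ℕ) : Set₁ where
  field
    Carrier : Set
    _+_ _*_ : Op₂ Carrier
    -_      : Op₁ Carrier
    0# 1#   : Carrier
    isField : IsField _+_ _*_ -_ 0# 1#
    elements     : List Carrier
    elements-all : ∀ x → x ∈ elements
    elements-uniq : Unique elements
    elements-len : length elements ≡ q

  _×1 : ℕ → Carrier
  zero ×1  = 0#
  suc n ×1 = 1# + (n ×1)

  -- Polynomials in F_q[x] as coefficient lists (constant term first);
  -- trailing zero coefficients are allowed (they do not change the
  -- polynomial; everything below is stated via `coeff`).

  Poly : Set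
  Poly = List Carrier

  coeff : Poly → ℕ → Carrier
  coeff []       _       = 0#
  coeff (a ∷ _)  zero    = a
  coeff (_ ∷ as) (suc i) = coeff as i

  infixl 6 _+ₚ_ _-ₚ_
  infixl 7 _*ₚ_ _·ₚ_

  _+ₚ_ : Poly → Poly → Poly
  []       +ₚ qs       = qs
  (p ∷ ps) +ₚ []       = p ∷ ps
  (p ∷ ps) +ₚ (r ∷ rs) = (p + r) ∷ (ps +ₚ rs)

  negₚ : Poly → Poly
  negₚ = map -_

  _-ₚ_ : Poly → Poly → Poly
  f -ₚ g = f +ₚ negₚ g

  _·ₚ_ : Carrier → Poly → Poly
  a ·ₚ g = map (a *_) g

  _*ₚ_ : Poly → Poly → Poly
  []       *ₚ g = []
  (a ∷ f)  *ₚ g = (a ·ₚ g) +ₚ (0# ∷ (f *ₚ g))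

  oneₚ : Poly
  oneₚ = 1# ∷ []

  _^ₚ_ : Poly → ℕ → Poly
  f ^ₚ zero  = oneₚ
  f ^ₚ suc k = f *ₚ (f ^ₚ k)

  -- deg f ≤ h  (with deg 0 = -∞): all coefficients of index > h vanish
  DegLe : Poly → ℤ → Set
  DegLe f h = ∀ (i : ℕ) → h ℤ.< + i → coeff f i ≡ 0#

  -- A monic polynomial of degree m is determined by its m lower
  -- coefficients c₀,…,c_{m-1}: c₀ + … + c_{m-1} x^{m-1} + x^m.
  -- So M_q(m) is represented (bijectively) by Vec Carrier m.
  monic : ∀ {m} → Vec Carrier m → Poly
  monic c = toList c Data.List.++ (1# ∷ [])

  InI : Poly → ℤ → Poly → Set
  InI F h Q = DegLe (F -ₚ Q) h

  -- S_q(d) membership for G ∈ M_q(d): ∃ A ∈ M_q with G^k A ∈ I_q(F,h)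
  InS : Poly → ℤ → ℕ → ∀ {d} → Vec Carrier d → Set
  InS F h k G = Σ ℕ (λ m → Σ (Vec Carrier m) (λ A →
                  InI F h ((monic G ^ₚ k) *ₚ monic A)))

open Data.List using (_++_)

HasChar : ∀ {q} → FiniteField q → ℕ → Set
HasChar K p = Prime p × (FiniteField._×1 K p ≡ FiniteField.0# K)

IsPrimePower : ℕ → Set
IsPrimePower q = Σ ℕ (λ p → Σ ℕ (λ m → Prime p × (0 < m) × (q ≡ p ℕ.^ m)))

LeastNonDiv : ℕ → ℕ → ℕ → Set
LeastNonDiv p k r = (1 ≤ r) × ¬ (p ∣ (k C r))
                  × (∀ s → 1 ≤ s → s < r → p ∣ (k C s))

-- "N ≤ q^(e/k)" for a natural N, integer e, positive k, stated without
-- real numbers: N^k ≤ q^e, i.e. N^k ≤ q^e for e ≥ 0 and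
-- N^k · q^{-e} ≤ 1 for e < 0.
RootBound : ℕ → ℕ → ℕ → ℤ → Set
RootBound q k N (+ e)      = N ℕ.^ k ≤ q ℕ.^ e
RootBound q k N -[1+ e ]   = (N ℕ.^ k) ℕ.* (q ℕ.^ suc e) ≤ 1

module Submission where

-- Let m = n − kd, so 0 ≤ m ≤ h.  If G ∈ S(d) with G^k A ≡ F above degree h, comparing
-- leading terms forces deg A = m.  For two members G, G′ put E = G − G′ and B = A − A′.
-- Since p divides every binomial coefficient (k choose s) with 0 < s < k, G^k = G′^k + E^k,
-- hence G^k A − G′^k A′ = E^k A′ + G^k B, and this vanishes above degree h.
-- If G and G′ share their e₂ = ⌊m/k⌋ highest non-leading coefficients, then
-- deg (E^k A′) < kd, so the leading term of G^k B survives above h unless B = 0.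
-- If they also share their e₁ = ⌊(h − m)/k⌋ + 1 lowest coefficients, then
-- deg (E^k A′) > h unless E = 0.  So a member of S(d) is determined by e₁ + e₂ coefficients,
-- |S(d)| ≤ q^(e₁ + e₂), and k (e₁ + e₂) ≤ h + k.

open import Level using (Level; 0ℓ)
open import Algebra.Bundles using (CommutativeRing; CommutativeSemiring)
open import Data.Nat as ℕ using (ℕ; NonZero; _≤_)
open import Data.Nat.Divisibility using (_∣_)
open import Data.Nat.Combinatorics using (_C_)
open import Data.Vec using (Vec)
open import Data.Product using (Σ; ∃; _,_; proj₁; proj₂)
open import Relation.Binary.PropositionalEquality
open import Defs

module FreshmansDream {a ℓ : Level} (S : CommutativeSemiring a ℓ) where
  open import Data.Nat using (suc; _<_; z<s; s<s; _∸_)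
  open import Data.Nat.Properties using (n∸n≡0)
  open import Data.Nat.Combinatorics using (_C_; nCn≡1)
  open import Data.Fin as Fin using (toℕ; fromℕ; inject₁)
  open import Data.Fin.Properties using (toℕ-fromℕ; toℕ-inject₁; toℕ<n)
  open import Data.Vec.Functional using (replicate)
  open CommutativeSemiring S renaming (sym to ≈-sym; trans to ≈-trans; setoid to ≈-setoid)
  open import Algebra.Properties.Semiring.Exp semiring using (_^_)
  open import Algebra.Properties.Semiring.Mult semiring using (_×_; ×-homo-1; ×-congʳ; ×-assoc-*)
  open import Algebra.Properties.Semiring.Sum semiring using (sum; sum-init-last; sum-cong-≋; sum-replicate-zero)
  open import Algebra.Properties.CommutativeSemiring.Binomial S using (theorem)
  open import Relation.Binary.Reasoning.Setoid ≈-setoid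

  freshmans-dream : ∀ k .{{_ : NonZero k}} → (∀ s → 0 < s → s < k → (k C s) × 1# ≈ 0#) →
                   ∀ x y → (x + y) ^ k ≈ x ^ k + y ^ k
  freshmans-dream (suc k) vanish x y = begin
    (x + y) ^ suc k
      ≈⟨ theorem (suc k) x y ⟩
    term Fin.zero + sum (λ j → term (Fin.suc j))
      ≈⟨ +-cong first (sum-init-last (λ j → term (Fin.suc j))) ⟩
    y ^ suc k + (sum (λ j → term (Fin.suc (inject₁ j))) + term (Fin.suc (fromℕ k)))
      ≈⟨ +-congˡ (+-cong (≈-trans (sum-cong-≋ inner) (sum-replicate-zero k)) (last _ (toℕ-fromℕ k))) ⟩
    y ^ suc k + (0# + x ^ suc k)
      ≈⟨ ≈-trans (+-congˡ (+-identityˡ _)) (+-comm _ _) ⟩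
    x ^ suc k + y ^ suc k ∎
    where
    open import Algebra.Properties.Semiring.Binomial semiring x y using (binomial; binomialTerm)
    term = binomialTerm (suc k)
    first : term Fin.zero ≈ y ^ suc k
    first = ≈-trans (×-homo-1 _) (*-identityˡ _)
    inner : ∀ j → term (Fin.suc (inject₁ j)) ≈ replicate k 0# j
    inner j = begin
      c × b              ≈⟨ ×-congʳ c (*-identityˡ b) ⟨
      c × (1# * b)       ≈⟨ ×-assoc-* c 1# b ⟨
      c × 1# * b         ≈⟨ *-congʳ (vanish s z<s (s<s (subst (_< k) (sym (toℕ-inject₁ j)) (toℕ<n j)))) ⟩
      0# * b             ≈⟨ zeroˡ b ⟩
      0#                 ∎
      where
      s = suc (toℕ (inject₁ j))
      c = suc k C s
      b = binomial (suc k) (Fin.suc (inject₁ j))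
    last : ∀ i → i ≡ k → (suc k C suc i) × (x ^ suc i * y ^ (k ∸ i)) ≈ x ^ suc k
    last i refl rewrite nCn≡1 (suc i) | n∸n≡0 i = ≈-trans (×-homo-1 _) (*-identityʳ _)

module Counting where
  open import Data.Nat.Properties using (≮⇒≥; _<?_)
  open import Data.Fin using (Fin; zero; suc; funToFin; finToFun)
  open import Data.Fin.Properties using (pigeonhole; finToFun-funToFin; <⇒≢)
  open import Data.List using (List; _∷_; length; lookup)
  open import Data.List.Membership.Propositional using (_∈_)
  open import Data.List.Membership.Propositional.Properties using (∈-lookup)
  open import Data.List.Relation.Unary.All as All using ()
  open import Data.List.Relation.Unary.AllPairs using (_∷_)
  open import Data.List.Relation.Unary.Unique.Propositional using (Unique)
  open import Data.Empty using (⊥-elim)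
  open import Function using (_∘_)
  open import Relation.Nullary using (yes; no)

  Unique⇒lookup-injective : ∀ {A : Set} {xs : List A} → Unique xs → ∀ i j → lookup xs i ≡ lookup xs j → i ≡ j
  Unique⇒lookup-injective (_ ∷ _) zero zero _ = refl
  Unique⇒lookup-injective (x∉ ∷ _) zero (suc j) eq = ⊥-elim (All.lookup x∉ (∈-lookup j) eq)
  Unique⇒lookup-injective (x∉ ∷ _) (suc i) zero eq = ⊥-elim (All.lookup x∉ (∈-lookup i) (sym eq))
  Unique⇒lookup-injective (_ ∷ u) (suc i) (suc j) eq = cong suc (Unique⇒lookup-injective u i j eq)

  Unique-length≤ : ∀ {A : Set} {n} {xs : List A} → Unique xs → (f : A → Fin n) →
                   (∀ {x y} → x ∈ xs → y ∈ xs → f x ≡ f y → x ≡ y) → length xs ≤ n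
  Unique-length≤ {n = n} {xs} u f f-inj with n <? length xs
  ... | no n≮ = ≮⇒≥ n≮
  ... | yes n< with pigeonhole n< (f ∘ lookup xs)
  ...   | i , j , i<j , eq = ⊥-elim (<⇒≢ i<j (Unique⇒lookup-injective u i j (f-inj (∈-lookup i) (∈-lookup j) eq)))

  funToFin-injective : ∀ {m n} (f g : Fin m → Fin n) → funToFin f ≡ funToFin g → ∀ i → f i ≡ g i
  funToFin-injective f g eq i = trans (sym (finToFun-funToFin f i)) (trans (cong (λ c → finToFun c i) eq) (finToFun-funToFin g i))

module Arithmetic where
  open import Data.Nat using (suc; _+_; _*_; _∸_; _/_; _%_; _<_)
  open import Data.Nat.Properties
  open import Data.Nat.DivMod using (m≡m%n+[m/n]*n; m%n<n; m/n*n≤m; m/n≤m)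

  m<n*[1+m/n] : ∀ m n .{{_ : NonZero n}} → m < n * suc (m / n)
  m<n*[1+m/n] m n = begin-strict
    m                      ≡⟨ m≡m%n+[m/n]*n m n ⟩
    m % n + m / n * n      <⟨ +-monoˡ-< (m / n * n) (m%n<n m n) ⟩
    n + m / n * n          ≡⟨ *-comm (suc (m / n)) n ⟩
    n * suc (m / n)        ∎
    where open ≤-Reasoning

  -- A member G of S(d) (where deg G^k A = kd + m) is recovered from its coefficients at the
  -- e₁ indices below e₁ and at the e₂ indices t + 1, …, d − 1.
  module CodeLength (k d m h : ℕ) .{{_ : NonZero k}} (m≤h : m ≤ h) (h<d : h < d) where
    e₁ = suc ((h ∸ m) / k)
    e₂ = m / k
    t = d ∸ suc e₂

    e₂<d : e₂ < d
    e₂<d = ≤-<-trans (m/n≤m m k) (≤-<-trans m≤h h<d)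

    1+t+e₂≡d : suc t + e₂ ≡ d
    1+t+e₂≡d = trans (sym (+-suc t e₂)) (m∸n+n≡m e₂<d)

    h<k*d : h < k * d
    h<k*d = <-≤-trans h<d (m≤n*m d k)

    h<k*e₁+m : h < k * e₁ + m
    h<k*e₁+m = begin-strict
      h                 ≡⟨ m∸n+n≡m m≤h ⟨
      (h ∸ m) + m       <⟨ +-monoˡ-< m (m<n*[1+m/n] (h ∸ m) k) ⟩
      k * e₁ + m        ∎
      where open ≤-Reasoning

    k*t+m<k*d : k * t + m < k * d
    k*t+m<k*d = begin-strict
      k * t + m             <⟨ +-monoʳ-< (k * t) (m<n*[1+m/n] m k) ⟩
      k * t + k * suc e₂    ≡⟨ *-distribˡ-+ k t (suc e₂) ⟨
      k * (t + suc e₂)      ≡⟨ cong (k *_) (m∸n+n≡m e₂<d) ⟩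
      k * d                 ∎
      where open ≤-Reasoning

    code-length : (e₁ + e₂) * k ≤ h + k
    code-length = begin
      (e₁ + e₂) * k                              ≡⟨ *-distribʳ-+ k e₁ e₂ ⟩
      (k + (h ∸ m) / k * k) + m / k * k          ≤⟨ +-mono-≤ (+-monoʳ-≤ k (m/n*n≤m (h ∸ m) k)) (m/n*n≤m m k) ⟩
      (k + (h ∸ m)) + m                          ≡⟨ +-assoc k (h ∸ m) m ⟩
      k + ((h ∸ m) + m)                          ≡⟨ cong (k +_) (m∸n+n≡m m≤h) ⟩
      k + h                                      ≡⟨ +-comm k h ⟩
      h + k                                      ∎
      where open ≤-Reasoning

module IntegerArithmetic where
  open import Data.Integer as ℤ using (+_; -[1+_]; _+_; _-_) renaming (_≤_ to _≤ℤ_)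
  open import Data.Product using (_×_)
  import Data.Integer.Properties as ℤ
  open import Relation.Nullary using (contradiction)

  m-n≤o⇒m≤o+n : ∀ {m o} n → + m - n ≤ℤ + o → + m ≤ℤ + o + n
  m-n≤o⇒m≤o+n {m} {o} n m-n≤o = subst (_≤ℤ + o + n) m-n+n≡m (ℤ.+-monoˡ-≤ n m-n≤o)
    where
    m-n+n≡m : + m - n + n ≡ + m
    m-n+n≡m = trans (ℤ.+-assoc (+ m) (ℤ.- n) n) (trans (cong (λ x → + m + x) (ℤ.+-inverseˡ n)) (ℤ.+-identityʳ (+ m)))

  excess-nonneg : ∀ {n c} h → + n - h ≤ℤ + c → + c ≤ℤ + n → ∃ λ h′ → h ≡ + h′ × n ℕ.≤ c ℕ.+ h′
  excess-nonneg (+ h′) n-h≤c _ = h′ , refl , ℤ.drop‿+≤+ (m-n≤o⇒m≤o+n (+ h′) n-h≤c)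
  excess-nonneg {c = c} -[1+ x ] n-h≤c c≤n =
    contradiction (ℤ.≤-<-trans c≤n (ℤ.≤-<-trans (m-n≤o⇒m≤o+n -[1+ x ] n-h≤c) (ℤ.m⊖1+n<m c (ℕ.suc x))))
                  (ℤ.<-irrefl refl)

module Polynomials {q : ℕ} (K : FiniteField q) where
  open import Algebra.Structures using (IsCommutativeMonoid)
  open import Algebra.Structures.Biased using (isCommutativeSemiringˡ; isCommutativeMonoidˡ)
  open import Data.Nat using (zero; suc; _<_; z≤n; s≤s)
  open import Data.Nat.Properties using (m≤n+m; ≤-trans; <⇒≤; m≤n⇒m<n∨m≡n; <-cmp)
  open import Data.Nat.Divisibility using (divides)
  open import Data.Fin as Fin using (Fin)
  open import Data.List using ([]; _∷_)
  open import Data.List.Relation.Unary.Any as Any using ()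
  import Data.List.Membership.Setoid.Properties as Membership
  open import Data.Product using (_×_)
  open import Data.Sum using (_⊎_; inj₁; inj₂)
  open import Data.Vec using ([]; _∷_)
  open import Relation.Nullary using (yes; no; contradiction)
  open import Relation.Binary.Definitions using (DecidableEquality; tri<; tri≈; tri>)
  open import Relation.Binary.Bundles using (Setoid)
  import Relation.Binary.Reasoning.Setoid as ≈-Reasoning
  open FiniteField K hiding (_+_; _*_; -_)
  open IsField isField using (isCommutativeRing; 0≢1; inverse)

  field-ring : CommutativeRing 0ℓ 0ℓ
  field-ring = record { isCommutativeRing = isCommutativeRing }

  open CommutativeRing field-ring public
    using (_+_; _*_; -_; _-_; +-comm; +-assoc; +-identityˡ; +-identityʳ; -‿inverseʳ;
           *-comm; *-assoc; *-identityˡ; zeroˡ; zeroʳ; distribʳ; commutativeSemiring)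
  open import Algebra.Properties.Ring (CommutativeRing.ring field-ring) public
    using (-0#≈0#; x∙y⁻¹≈ε⇒x≈y; +-identityʳ-unique)
  open import Algebra.Definitions.RawSemiring (CommutativeSemiring.rawSemiring commutativeSemiring) public using (_^_)

  index : Carrier → Fin q
  index x = subst Fin elements-len (Any.index (elements-all x))

  index-injective : ∀ {x y} → index x ≡ index y → x ≡ y
  index-injective {x} {y} eq =
    Membership.index-injective (setoid Carrier) (elements-all x) (elements-all y) (subst-injective elements-len eq)

  infix 4 _≟_
  _≟_ : DecidableEquality Carrier
  x ≟ y with index x Fin.≟ index y
  ... | yes eq  = yes (index-injective eq)
  ... | no  neq = no λ { refl → neq refl }

  open import Algebra.Solver.Ring.NaturalCoefficients.Default commutativeSemiring
    using (solve; _:+_; _:*_; _:=_)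

  *-≢0 : ∀ {x y} → x ≢ 0# → y ≢ 0# → x * y ≢ 0#
  *-≢0 {x} {y} x≢0 y≢0 xy≡0 with inverse x x≢0
  ... | x⁻¹ , xx⁻¹≡1 = y≢0 (begin
    y                ≡⟨ *-identityˡ y ⟨
    1# * y           ≡⟨ cong (_* y) (trans (sym xx⁻¹≡1) (*-comm x x⁻¹)) ⟩
    (x⁻¹ * x) * y    ≡⟨ *-assoc x⁻¹ x y ⟩
    x⁻¹ * (x * y)    ≡⟨ cong (x⁻¹ *_) xy≡0 ⟩
    x⁻¹ * 0#         ≡⟨ zeroʳ x⁻¹ ⟩
    0#               ∎)
    where open ≡-Reasoning

  1≢0 : 1# ≢ 0#
  1≢0 = ≢-sym 0≢1

  ^-≢0 : ∀ {x} k → x ≢ 0# → x ^ k ≢ 0#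
  ^-≢0 zero    x≢0 = 1≢0
  ^-≢0 (suc k) x≢0 = *-≢0 x≢0 (^-≢0 k x≢0)

  -- A record rather than a function type, so that Agda can infer the polynomials from a proof.
  infix 4 _≈ₚ_
  record _≈ₚ_ (f g : Poly) : Set where
    constructor coeffwise
    field coeff-≡ : ∀ i → coeff f i ≡ coeff g i
  open _≈ₚ_ public

  coeff-+ₚ : ∀ f g i → coeff (f +ₚ g) i ≡ coeff f i + coeff g i
  coeff-+ₚ []       g        i       = sym (+-identityˡ _)
  coeff-+ₚ (a ∷ f)  []       i       = sym (+-identityʳ _)
  coeff-+ₚ (a ∷ f)  (b ∷ g)  zero    = refl
  coeff-+ₚ (a ∷ f)  (b ∷ g)  (suc i) = coeff-+ₚ f g i

  coeff-·ₚ : ∀ a g i → coeff (a ·ₚ g) i ≡ a * coeff g i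
  coeff-·ₚ a []      i       = sym (zeroʳ a)
  coeff-·ₚ a (b ∷ g) zero    = refl
  coeff-·ₚ a (b ∷ g) (suc i) = coeff-·ₚ a g i

  coeff-negₚ : ∀ g i → coeff (negₚ g) i ≡ - coeff g i
  coeff-negₚ []      i       = sym -0#≈0#
  coeff-negₚ (b ∷ g) zero    = refl
  coeff-negₚ (b ∷ g) (suc i) = coeff-negₚ g i

  coeff--ₚ : ∀ f g i → coeff (f -ₚ g) i ≡ coeff f i - coeff g i
  coeff--ₚ f g i = trans (coeff-+ₚ f (negₚ g) i) (cong (coeff f i +_) (coeff-negₚ g i))

  coeff-∷*ₚ : ∀ a f g i → coeff ((a ∷ f) *ₚ g) i ≡ a * coeff g i + coeff (0# ∷ f *ₚ g) i
  coeff-∷*ₚ a f g i = trans (coeff-+ₚ (a ·ₚ g) _ i) (cong (_+ coeff (0# ∷ f *ₚ g) i) (coeff-·ₚ a g i))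

  coeff-∷*ₚ-zero : ∀ a f g → coeff ((a ∷ f) *ₚ g) zero ≡ a * coeff g zero
  coeff-∷*ₚ-zero a f g = trans (coeff-∷*ₚ a f g zero) (+-identityʳ _)

  ≈ₚ-setoid : Setoid 0ℓ 0ℓ
  ≈ₚ-setoid = record
    { Carrier = Poly
    ; _≈_ = _≈ₚ_
    ; isEquivalence = record
      { refl = coeffwise λ _ → refl
      ; sym = λ f≈g → coeffwise λ i → sym (coeff-≡ f≈g i)
      ; trans = λ f≈g g≈h → coeffwise λ i → trans (coeff-≡ f≈g i) (coeff-≡ g≈h i)
      }
    }

  open Setoid ≈ₚ-setoid public using () renaming (refl to ≈ₚ-refl; sym to ≈ₚ-sym; trans to ≈ₚ-trans)

  ∷-congʳ : ∀ a {f g} → f ≈ₚ g → a ∷ f ≈ₚ a ∷ g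
  ∷-congʳ a f≈g = coeffwise λ { zero → refl ; (suc i) → coeff-≡ f≈g i }

  +ₚ-cong : ∀ {f f′ g g′} → f ≈ₚ f′ → g ≈ₚ g′ → f +ₚ g ≈ₚ f′ +ₚ g′
  +ₚ-cong {f} {f′} {g} {g′} f≈ g≈ = coeffwise λ i → begin
    coeff (f +ₚ g) i          ≡⟨ coeff-+ₚ f g i ⟩
    coeff f i + coeff g i     ≡⟨ cong₂ _+_ (coeff-≡ f≈ i) (coeff-≡ g≈ i) ⟩
    coeff f′ i + coeff g′ i   ≡⟨ coeff-+ₚ f′ g′ i ⟨
    coeff (f′ +ₚ g′) i        ∎
    where open ≡-Reasoning

  +ₚ-assoc : ∀ f g h → (f +ₚ g) +ₚ h ≈ₚ f +ₚ (g +ₚ h)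
  +ₚ-assoc f g h = coeffwise λ i → begin
    coeff ((f +ₚ g) +ₚ h) i                ≡⟨ trans (coeff-+ₚ (f +ₚ g) h i) (cong (_+ coeff h i) (coeff-+ₚ f g i)) ⟩
    (coeff f i + coeff g i) + coeff h i    ≡⟨ +-assoc _ _ _ ⟩
    coeff f i + (coeff g i + coeff h i)    ≡⟨ trans (coeff-+ₚ f (g +ₚ h) i) (cong (coeff f i +_) (coeff-+ₚ g h i)) ⟨
    coeff (f +ₚ (g +ₚ h)) i                ∎
    where open ≡-Reasoning

  +ₚ-comm : ∀ f g → f +ₚ g ≈ₚ g +ₚ f
  +ₚ-comm f g = coeffwise λ i → trans (coeff-+ₚ f g i) (trans (+-comm _ _) (sym (coeff-+ₚ g f i)))

  *ₚ-congʳ : ∀ f {g g′} → g ≈ₚ g′ → f *ₚ g ≈ₚ f *ₚ g′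
  *ₚ-congʳ []      g≈ = ≈ₚ-refl
  *ₚ-congʳ (a ∷ f) {g} {g′} g≈ = coeffwise λ i → begin
    coeff ((a ∷ f) *ₚ g) i                          ≡⟨ coeff-∷*ₚ a f g i ⟩
    a * coeff g i + coeff (0# ∷ f *ₚ g) i
      ≡⟨ cong₂ (λ u v → a * u + v) (coeff-≡ g≈ i) (coeff-≡ (∷-congʳ 0# (*ₚ-congʳ f g≈)) i) ⟩
    a * coeff g′ i + coeff (0# ∷ f *ₚ g′) i         ≡⟨ coeff-∷*ₚ a f g′ i ⟨
    coeff ((a ∷ f) *ₚ g′) i                         ∎
    where open ≡-Reasoning

  *ₚ-distribʳ : ∀ h f g → (f +ₚ g) *ₚ h ≈ₚ f *ₚ h +ₚ g *ₚ h
  *ₚ-distribʳ h []      g  = ≈ₚ-refl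
  *ₚ-distribʳ h (a ∷ f) [] = coeffwise λ i → sym (trans (coeff-+ₚ ((a ∷ f) *ₚ h) [] i) (+-identityʳ _))
  *ₚ-distribʳ h (a ∷ f) (b ∷ g) = coeffwise λ i → begin
    coeff ((a + b ∷ f +ₚ g) *ₚ h) i                 ≡⟨ coeff-∷*ₚ (a + b) (f +ₚ g) h i ⟩
    (a + b) * x i + coeff (0# ∷ (f +ₚ g) *ₚ h) i    ≡⟨ cong ((a + b) * x i +_) (shifted i) ⟩
    (a + b) * x i + (u i + v i)
      ≡⟨ solve 5 (λ a b x u v → (a :+ b) :* x :+ (u :+ v) := (a :* x :+ u) :+ (b :* x :+ v)) refl a b (x i) (u i) (v i) ⟩
    (a * x i + u i) + (b * x i + v i)               ≡⟨ cong₂ _+_ (coeff-∷*ₚ a f h i) (coeff-∷*ₚ b g h i) ⟨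
    coeff ((a ∷ f) *ₚ h) i + coeff ((b ∷ g) *ₚ h) i ≡⟨ coeff-+ₚ ((a ∷ f) *ₚ h) _ i ⟨
    coeff ((a ∷ f) *ₚ h +ₚ (b ∷ g) *ₚ h) i          ∎
    where
    open ≡-Reasoning
    x = coeff h
    u = coeff (0# ∷ f *ₚ h)
    v = coeff (0# ∷ g *ₚ h)
    shifted : ∀ i → coeff (0# ∷ (f +ₚ g) *ₚ h) i ≡ u i + v i
    shifted zero    = sym (+-identityˡ 0#)
    shifted (suc i) = trans (coeff-≡ (*ₚ-distribʳ h f g) i) (coeff-+ₚ (f *ₚ h) (g *ₚ h) i)

  ·ₚ-*ₚ-assoc : ∀ a g h → (a ·ₚ g) *ₚ h ≈ₚ a ·ₚ (g *ₚ h)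
  ·ₚ-*ₚ-assoc a []      h = ≈ₚ-refl
  ·ₚ-*ₚ-assoc a (b ∷ g) h = coeffwise λ i → begin
    coeff ((a * b ∷ a ·ₚ g) *ₚ h) i               ≡⟨ coeff-∷*ₚ (a * b) (a ·ₚ g) h i ⟩
    a * b * x i + coeff (0# ∷ (a ·ₚ g) *ₚ h) i    ≡⟨ cong (a * b * x i +_) (shifted i) ⟩
    a * b * x i + a * u i
      ≡⟨ solve 4 (λ a b x u → a :* b :* x :+ a :* u := a :* (b :* x :+ u)) refl a b (x i) (u i) ⟩
    a * (b * x i + u i)                           ≡⟨ trans (coeff-·ₚ a ((b ∷ g) *ₚ h) i) (cong (a *_) (coeff-∷*ₚ b g h i)) ⟨
    coeff (a ·ₚ ((b ∷ g) *ₚ h)) i                 ∎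
    where
    open ≡-Reasoning
    x = coeff h
    u = coeff (0# ∷ g *ₚ h)
    shifted : ∀ i → coeff (0# ∷ (a ·ₚ g) *ₚ h) i ≡ a * u i
    shifted zero    = sym (zeroʳ a)
    shifted (suc i) = trans (coeff-≡ (·ₚ-*ₚ-assoc a g h) i) (coeff-·ₚ a (g *ₚ h) i)

  0∷-*ₚ : ∀ f h → (0# ∷ f) *ₚ h ≈ₚ 0# ∷ f *ₚ h
  0∷-*ₚ f h = coeffwise λ i →
    trans (coeff-∷*ₚ 0# f h i) (trans (cong (_+ coeff (0# ∷ f *ₚ h) i) (zeroˡ (coeff h i))) (+-identityˡ _))

  *ₚ-assoc : ∀ f g h → (f *ₚ g) *ₚ h ≈ₚ f *ₚ (g *ₚ h)
  *ₚ-assoc []      g h = ≈ₚ-refl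
  *ₚ-assoc (a ∷ f) g h = begin
    (a ·ₚ g +ₚ (0# ∷ f *ₚ g)) *ₚ h           ≈⟨ *ₚ-distribʳ h (a ·ₚ g) _ ⟩
    (a ·ₚ g) *ₚ h +ₚ (0# ∷ f *ₚ g) *ₚ h      ≈⟨ +ₚ-cong (·ₚ-*ₚ-assoc a g h) (0∷-*ₚ (f *ₚ g) h) ⟩
    a ·ₚ (g *ₚ h) +ₚ (0# ∷ (f *ₚ g) *ₚ h)    ≈⟨ +ₚ-cong ≈ₚ-refl (∷-congʳ 0# (*ₚ-assoc f g h)) ⟩
    a ·ₚ (g *ₚ h) +ₚ (0# ∷ f *ₚ (g *ₚ h))    ∎
    where open ≈-Reasoning ≈ₚ-setoid

  *ₚ-zeroʳ : ∀ f → f *ₚ [] ≈ₚ []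
  *ₚ-zeroʳ []      = ≈ₚ-refl
  *ₚ-zeroʳ (a ∷ f) = coeffwise λ { zero → refl ; (suc i) → coeff-≡ (*ₚ-zeroʳ f) i }

  *ₚ-∷ʳ : ∀ f b g → f *ₚ (b ∷ g) ≈ₚ b ·ₚ f +ₚ (0# ∷ f *ₚ g)
  *ₚ-∷ʳ []      b g = coeffwise λ { zero → refl ; (suc i) → refl }
  *ₚ-∷ʳ (a ∷ f) b g = coeffwise coeffs
    where
    open ≡-Reasoning
    u = coeff (0# ∷ f *ₚ g)
    coeffs : ∀ i → coeff ((a ∷ f) *ₚ (b ∷ g)) i ≡ coeff (b ·ₚ (a ∷ f) +ₚ (0# ∷ (a ∷ f) *ₚ g)) i
    coeffs zero = begin
      coeff ((a ∷ f) *ₚ (b ∷ g)) zero                  ≡⟨ coeff-∷*ₚ-zero a f (b ∷ g) ⟩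
      a * b                                            ≡⟨ trans (*-comm a b) (sym (+-identityʳ _)) ⟩
      b * a + 0#                                       ≡⟨ coeff-+ₚ (b ·ₚ (a ∷ f)) (0# ∷ (a ∷ f) *ₚ g) zero ⟨
      coeff (b ·ₚ (a ∷ f) +ₚ (0# ∷ (a ∷ f) *ₚ g)) zero ∎
    coeffs (suc i) = begin
      coeff ((a ∷ f) *ₚ (b ∷ g)) (suc i)             ≡⟨ coeff-∷*ₚ a f (b ∷ g) (suc i) ⟩
      a * coeff g i + coeff (f *ₚ (b ∷ g)) i
        ≡⟨ cong (a * coeff g i +_) (trans (coeff-≡ (*ₚ-∷ʳ f b g) i) (coeff-+ₚ (b ·ₚ f) _ i)) ⟩
      a * coeff g i + (coeff (b ·ₚ f) i + u i)
        ≡⟨ solve 3 (λ x y u → x :+ (y :+ u) := y :+ (x :+ u)) refl (a * coeff g i) _ (u i) ⟩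
      coeff (b ·ₚ f) i + (a * coeff g i + u i)       ≡⟨ cong (coeff (b ·ₚ f) i +_) (coeff-∷*ₚ a f g i) ⟨
      coeff (b ·ₚ f) i + coeff ((a ∷ f) *ₚ g) i      ≡⟨ coeff-+ₚ (b ·ₚ (a ∷ f)) (0# ∷ (a ∷ f) *ₚ g) (suc i) ⟨
      coeff (b ·ₚ (a ∷ f) +ₚ (0# ∷ (a ∷ f) *ₚ g)) (suc i) ∎

  *ₚ-comm : ∀ f g → f *ₚ g ≈ₚ g *ₚ f
  *ₚ-comm []      g = ≈ₚ-sym (*ₚ-zeroʳ g)
  *ₚ-comm (a ∷ f) g = begin
    a ·ₚ g +ₚ (0# ∷ f *ₚ g)   ≈⟨ +ₚ-cong ≈ₚ-refl (∷-congʳ 0# (*ₚ-comm f g)) ⟩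
    a ·ₚ g +ₚ (0# ∷ g *ₚ f)   ≈⟨ *ₚ-∷ʳ g a f ⟨
    g *ₚ (a ∷ f)              ∎
    where open ≈-Reasoning ≈ₚ-setoid

  *ₚ-identityˡ : ∀ f → oneₚ *ₚ f ≈ₚ f
  *ₚ-identityˡ f = coeffwise λ i →
    trans (coeff-∷*ₚ 1# [] f i) (trans (cong₂ _+_ (*-identityˡ _) (coeff-0∷[] i)) (+-identityʳ _))
    where
    coeff-0∷[] : ∀ i → coeff (0# ∷ []) i ≡ 0#
    coeff-0∷[] zero    = refl
    coeff-0∷[] (suc i) = refl

  *ₚ-cong : ∀ {f f′ g g′} → f ≈ₚ f′ → g ≈ₚ g′ → f *ₚ g ≈ₚ f′ *ₚ g′
  *ₚ-cong {f} {f′} {g} {g′} f≈ g≈ = begin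
    f *ₚ g     ≈⟨ *ₚ-congʳ f g≈ ⟩
    f *ₚ g′    ≈⟨ *ₚ-comm f g′ ⟩
    g′ *ₚ f    ≈⟨ *ₚ-congʳ g′ f≈ ⟩
    g′ *ₚ f′   ≈⟨ *ₚ-comm g′ f′ ⟩
    f′ *ₚ g′   ∎
    where open ≈-Reasoning ≈ₚ-setoid

  +ₚ-isCommutativeMonoid : IsCommutativeMonoid _≈ₚ_ _+ₚ_ []
  +ₚ-isCommutativeMonoid = isCommutativeMonoidˡ record
    { isSemigroup = record
      { isMagma = record { isEquivalence = Setoid.isEquivalence ≈ₚ-setoid ; ∙-cong = +ₚ-cong }
      ; assoc = +ₚ-assoc }
    ; identityˡ = λ _ → ≈ₚ-refl
    ; comm = +ₚ-comm }

  *ₚ-isCommutativeMonoid : IsCommutativeMonoid _≈ₚ_ _*ₚ_ oneₚ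
  *ₚ-isCommutativeMonoid = isCommutativeMonoidˡ record
    { isSemigroup = record
      { isMagma = record { isEquivalence = Setoid.isEquivalence ≈ₚ-setoid ; ∙-cong = *ₚ-cong }
      ; assoc = *ₚ-assoc }
    ; identityˡ = *ₚ-identityˡ
    ; comm = *ₚ-comm }

  poly-semiring : CommutativeSemiring 0ℓ 0ℓ
  poly-semiring = record
    { isCommutativeSemiring = isCommutativeSemiringˡ record
      { +-isCommutativeMonoid = +ₚ-isCommutativeMonoid
      ; *-isCommutativeMonoid = *ₚ-isCommutativeMonoid
      ; distribʳ = *ₚ-distribʳ
      ; zeroˡ = λ _ → ≈ₚ-refl
      }
    }

  Degree≤ : Poly → ℕ → Set
  Degree≤ f e = ∀ i → e < i → coeff f i ≡ 0#

  Leading : Poly → ℕ → Carrier → Set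
  Leading f e c = Degree≤ f e × coeff f e ≡ c

  HasDegree : Poly → ℕ → Set
  HasDegree f e = Degree≤ f e × coeff f e ≢ 0#

  ≈[]⇒Degree≤ : ∀ {f} → f ≈ₚ [] → ∀ e → Degree≤ f e
  ≈[]⇒Degree≤ f≈[] e i _ = coeff-≡ f≈[] i

  ≈[]⊎HasDegree : ∀ f → f ≈ₚ [] ⊎ ∃ (HasDegree f)
  ≈[]⊎HasDegree [] = inj₁ ≈ₚ-refl
  ≈[]⊎HasDegree (a ∷ f) with ≈[]⊎HasDegree f
  ... | inj₂ (e , f≤e , fₑ≢0) = inj₂ (suc e , (λ { (suc i) (s≤s e<i) → f≤e i e<i }) , fₑ≢0)
  ... | inj₁ f≈[] with a ≟ 0#
  ...   | yes a≡0 = inj₁ (coeffwise λ { zero → a≡0 ; (suc i) → coeff-≡ f≈[] i })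
  ...   | no  a≢0 = inj₂ (zero , (λ { (suc i) _ → coeff-≡ f≈[] i }) , a≢0)

  *ₚ-leading : ∀ f g {a b u v} → Leading f a u → Leading g b v → Leading (f *ₚ g) (a ℕ.+ b) (u * v)
  *ₚ-leading [] g (_ , refl) _ = (λ _ _ → refl) , sym (zeroˡ _)
  *ₚ-leading (c ∷ f) g {zero} {b} (f≤0 , refl) (g≤b , refl) = degree , top
    where
    tail≈[] : f *ₚ g ≈ₚ []
    tail≈[] = *ₚ-cong {f} {[]} (coeffwise λ i → f≤0 (suc i) (s≤s z≤n)) ≈ₚ-refl
    tail-zero : ∀ i → coeff (0# ∷ f *ₚ g) i ≡ 0#
    tail-zero zero    = refl
    tail-zero (suc i) = coeff-≡ tail≈[] i
    coeff-head : ∀ i → coeff ((c ∷ f) *ₚ g) i ≡ c * coeff g i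
    coeff-head i = trans (coeff-∷*ₚ c f g i) (trans (cong (c * coeff g i +_) (tail-zero i)) (+-identityʳ _))
    degree : Degree≤ ((c ∷ f) *ₚ g) b
    degree i b<i = trans (coeff-head i) (trans (cong (c *_) (g≤b i b<i)) (zeroʳ c))
    top : coeff ((c ∷ f) *ₚ g) b ≡ c * coeff g b
    top = coeff-head b
  *ₚ-leading (c ∷ f) g {suc a} {b} (f≤a , refl) (g≤b , refl) = degree , top
    where
    ih = *ₚ-leading f g {a} {b} ((λ i a<i → f≤a (suc i) (s≤s a<i)) , refl) (g≤b , refl)
    head-vanishes : ∀ i → b ≤ i → c * coeff g (suc i) ≡ 0#
    head-vanishes i b≤i = trans (cong (c *_) (g≤b (suc i) (s≤s b≤i))) (zeroʳ c)
    degree : Degree≤ ((c ∷ f) *ₚ g) (suc a ℕ.+ b)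
    degree (suc i) (s≤s a+b<i) =
      trans (coeff-∷*ₚ c f g (suc i))
        (trans (cong₂ _+_ (head-vanishes i (≤-trans (m≤n+m b a) (<⇒≤ a+b<i))) (proj₁ ih i a+b<i)) (+-identityˡ 0#))
    top : coeff ((c ∷ f) *ₚ g) (suc a ℕ.+ b) ≡ coeff f a * coeff g b
    top = trans (coeff-∷*ₚ c f g (suc (a ℕ.+ b)))
            (trans (cong₂ _+_ (head-vanishes (a ℕ.+ b) (m≤n+m b a)) (proj₂ ih)) (+-identityˡ _))

  ^ₚ-leading : ∀ f {e u} k → Leading f e u → Leading (f ^ₚ k) (k ℕ.* e) (u ^ k)
  ^ₚ-leading f zero    _  = (λ { (suc i) _ → refl }) , refl
  ^ₚ-leading f (suc k) lf = *ₚ-leading f (f ^ₚ k) lf (^ₚ-leading f k lf)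

  monic-leading : ∀ {d} (c : Vec Carrier d) → Leading (monic c) d 1#
  monic-leading []      = (λ { (suc i) _ → refl }) , refl
  monic-leading (a ∷ c) = (λ { (suc i) (s≤s d<i) → proj₁ (monic-leading c) i d<i }) , proj₂ (monic-leading c)

  monic-injective : ∀ {d} (c c′ : Vec Carrier d) → monic c ≈ₚ monic c′ → c ≡ c′
  monic-injective []      []        _  = refl
  monic-injective (a ∷ c) (a′ ∷ c′) eq =
    cong₂ _∷_ (coeff-≡ eq zero) (monic-injective c c′ (coeffwise λ i → coeff-≡ eq (suc i)))

  monic-coeff-≥ : ∀ {d} (c c′ : Vec Carrier d) i → d ≤ i → coeff (monic c) i ≡ coeff (monic c′) i
  monic-coeff-≥ {d} c c′ i d≤i with m≤n⇒m<n∨m≡n d≤i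
  ... | inj₁ d<i  = trans (proj₁ (monic-leading c) i d<i) (sym (proj₁ (monic-leading c′) i d<i))
  ... | inj₂ refl = trans (proj₂ (monic-leading c)) (sym (proj₂ (monic-leading c′)))

  coeff-≡⇒coeff[f-g]≡0 : ∀ f g i → coeff f i ≡ coeff g i → coeff (f -ₚ g) i ≡ 0#
  coeff-≡⇒coeff[f-g]≡0 f g i fᵢ≡gᵢ = trans (coeff--ₚ f g i) (trans (cong (_- coeff g i) fᵢ≡gᵢ) (-‿inverseʳ _))

  coeff[f-g]≡0⇒coeff-≡ : ∀ f g i → coeff (f -ₚ g) i ≡ 0# → coeff f i ≡ coeff g i
  coeff[f-g]≡0⇒coeff-≡ f g i [f-g]ᵢ≡0 = x∙y⁻¹≈ε⇒x≈y _ _ (trans (sym (coeff--ₚ f g i)) [f-g]ᵢ≡0)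

  Degree≤[f-g]⇒coeff-≡ : ∀ f g {h} → Degree≤ (f -ₚ g) h → ∀ i → h < i → coeff f i ≡ coeff g i
  Degree≤[f-g]⇒coeff-≡ f g f-g≤h i h<i = coeff[f-g]≡0⇒coeff-≡ f g i (f-g≤h i h<i)

  leading-cancels : ∀ u v {a c α h} → Degree≤ (u +ₚ v) h → Leading u a α → Degree≤ v c → h < a → c < a → α ≡ 0#
  leading-cancels u v {a} u+v≤h (_ , refl) v≤c h<a c<a = begin
    coeff u a                 ≡⟨ +-identityʳ _ ⟨
    coeff u a + 0#            ≡⟨ cong (coeff u a +_) (v≤c a c<a) ⟨
    coeff u a + coeff v a     ≡⟨ coeff-+ₚ u v a ⟨
    coeff (u +ₚ v) a          ≡⟨ u+v≤h a h<a ⟩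
    0#                        ∎
    where open ≡-Reasoning

  Leading⇒HasDegree : ∀ f {e c} → Leading f e c → c ≢ 0# → HasDegree f e
  Leading⇒HasDegree f (f≤e , refl) c≢0 = f≤e , c≢0

  degree-unique : ∀ f g {a b h} → HasDegree f a → HasDegree g b → h < a → h < b →
                  Degree≤ (f -ₚ g) h → a ≡ b
  degree-unique f g {a} {b} (f≤a , fₐ≢0) (g≤b , g_b≢0) h<a h<b f-g≤h with <-cmp a b
  ... | tri≈ _ a≡b _ = a≡b
  ... | tri< a<b _ _ = contradiction (trans (sym (Degree≤[f-g]⇒coeff-≡ f g f-g≤h b h<b)) (f≤a b a<b)) g_b≢0
  ... | tri> _ _ b<a = contradiction (trans (Degree≤[f-g]⇒coeff-≡ f g f-g≤h a h<a) (g≤b a b<a)) fₐ≢0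

  monic-power-product-degree : ∀ {d m} k (G : Vec Carrier d) (A : Vec Carrier m) →
                               HasDegree (monic G ^ₚ k *ₚ monic A) (k ℕ.* d ℕ.+ m)
  monic-power-product-degree k G A = Leading⇒HasDegree (monic G ^ₚ k *ₚ monic A)
    (*ₚ-leading (monic G ^ₚ k) (monic A) (^ₚ-leading (monic G) k (monic-leading G)) (monic-leading A))
    (*-≢0 (^-≢0 k 1≢0) 1≢0)

  ×1-homo-+ : ∀ a b → (a ℕ.+ b) ×1 ≡ a ×1 + b ×1
  ×1-homo-+ zero    b = sym (+-identityˡ _)
  ×1-homo-+ (suc a) b = trans (cong (1# +_) (×1-homo-+ a b)) (sym (+-assoc _ _ _))

  ∣⇒×1≡0 : ∀ {p c} → p ×1 ≡ 0# → p ∣ c → c ×1 ≡ 0#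
  ∣⇒×1≡0 {p} p×1≡0 (divides j refl) = multiple j
    where
    multiple : ∀ j → (j ℕ.* p) ×1 ≡ 0#
    multiple zero    = refl
    multiple (suc j) = trans (×1-homo-+ p (j ℕ.* p)) (trans (cong₂ _+_ p×1≡0 (multiple j)) (+-identityˡ 0#))

  open CommutativeSemiring poly-semiring using () renaming (semiring to poly-semiring′)
  open import Algebra.Properties.Semiring.Mult poly-semiring′ using () renaming (_×_ to _×ₚ_)
  open import Algebra.Properties.Semiring.Exp poly-semiring′ using () renaming (_^_ to _^ₛ_)
  open FreshmansDream poly-semiring using (freshmans-dream)

  coeff-×ₚ : ∀ c f i → coeff (c ×ₚ f) i ≡ (c ×1) * coeff f i
  coeff-×ₚ zero    f i = sym (zeroˡ _)
  coeff-×ₚ (suc c) f i = begin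
    coeff (f +ₚ c ×ₚ f) i                   ≡⟨ coeff-+ₚ f (c ×ₚ f) i ⟩
    coeff f i + coeff (c ×ₚ f) i            ≡⟨ cong₂ _+_ (sym (*-identityˡ _)) (coeff-×ₚ c f i) ⟩
    1# * coeff f i + (c ×1) * coeff f i     ≡⟨ distribʳ (coeff f i) 1# (c ×1) ⟨
    (1# + c ×1) * coeff f i                 ∎
    where open ≡-Reasoning

  ^ₚ≡^ₛ : ∀ f k → f ^ₚ k ≡ f ^ₛ k
  ^ₚ≡^ₛ f zero    = refl
  ^ₚ≡^ₛ f (suc k) = cong (f *ₚ_) (^ₚ≡^ₛ f k)

  frobenius : ∀ {p} → p ×1 ≡ 0# → ∀ k .{{_ : NonZero k}} → (∀ s → 0 < s → s < k → p ∣ (k C s)) →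
              ∀ f g → (f +ₚ g) ^ₚ k ≈ₚ f ^ₚ k +ₚ g ^ₚ k
  frobenius p×1≡0 k p∣C f g
    rewrite ^ₚ≡^ₛ (f +ₚ g) k | ^ₚ≡^ₛ f k | ^ₚ≡^ₛ g k =
    freshmans-dream k (λ s 0<s s<k → coeffwise λ i →
      trans (coeff-×ₚ (k C s) oneₚ i)
        (trans (cong (_* coeff oneₚ i) (∣⇒×1≡0 p×1≡0 (p∣C s 0<s s<k))) (zeroˡ _))) f g

  ^ₚ-cong : ∀ k {f g} → f ≈ₚ g → f ^ₚ k ≈ₚ g ^ₚ k
  ^ₚ-cong zero    f≈g = ≈ₚ-refl
  ^ₚ-cong (suc k) f≈g = *ₚ-cong f≈g (^ₚ-cong k f≈g)

  Degree≤-cong : ∀ {f g e} → f ≈ₚ g → Degree≤ f e → Degree≤ g e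
  Degree≤-cong f≈g f≤e i e<i = trans (sym (coeff-≡ f≈g i)) (f≤e i e<i)

  f≈g+[f-g] : ∀ f g → f ≈ₚ g +ₚ (f -ₚ g)
  f≈g+[f-g] f g = coeffwise λ i → begin
    coeff f i                           ≡⟨ +-identityˡ (coeff f i) ⟨
    0# + coeff f i                      ≡⟨ cong (_+ coeff f i) (-‿inverseʳ (coeff g i)) ⟨
    (coeff g i - coeff g i) + coeff f i
      ≡⟨ solve 3 (λ y y′ x → (y :+ y′) :+ x := y :+ (x :+ y′)) refl (coeff g i) (- coeff g i) (coeff f i) ⟩
    coeff g i + (coeff f i - coeff g i) ≡⟨ cong (coeff g i +_) (coeff--ₚ f g i) ⟨
    coeff g i + coeff (f -ₚ g) i       ≡⟨ coeff-+ₚ g (f -ₚ g) i ⟨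
    coeff (g +ₚ (f -ₚ g)) i            ∎
    where open ≡-Reasoning


module MonicPowers {q : ℕ} (K : FiniteField q) {p} (p×1≡0 : FiniteField._×1 K p ≡ FiniteField.0# K)
  {k} .{{_ : NonZero k}} (p∣C : ∀ s → 0 ℕ.< s → s ℕ.< k → p ∣ (k C s)) where
  open import Data.Nat using (_<_; z≤n)
  open import Data.Nat.Properties using (m≤m+n; <-≤-trans; ≤-<-trans; _≤?_; ≰⇒>; +-monoˡ-≤; *-monoʳ-≤)
  open import Data.List using ([])
  open import Data.Sum using (inj₁; inj₂)
  open import Relation.Nullary using (yes; no; contradiction)
  import Relation.Binary.Reasoning.Setoid as ≈-Reasoning
  open FiniteField K hiding (_+_; _*_; -_)
  open Polynomials K

  open CommutativeSemiring poly-semiring using () renaming (distribˡ to *ₚ-distribˡ)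

  power-product-split : ∀ G G′ A A′ →
    G ^ₚ k *ₚ A ≈ₚ G′ ^ₚ k *ₚ A′ +ₚ ((G -ₚ G′) ^ₚ k *ₚ A′ +ₚ G ^ₚ k *ₚ (A -ₚ A′))
  power-product-split G G′ A A′ = begin
    P *ₚ A                                ≈⟨ *ₚ-congʳ P (f≈g+[f-g] A A′) ⟩
    P *ₚ (A′ +ₚ B)                        ≈⟨ *ₚ-distribˡ P A′ B ⟩
    P *ₚ A′ +ₚ P *ₚ B                     ≈⟨ +ₚ-cong (*ₚ-cong P≈P′+Q ≈ₚ-refl) ≈ₚ-refl ⟩
    (P′ +ₚ Q) *ₚ A′ +ₚ P *ₚ B             ≈⟨ +ₚ-cong (*ₚ-distribʳ A′ P′ Q) ≈ₚ-refl ⟩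
    (P′ *ₚ A′ +ₚ Q *ₚ A′) +ₚ P *ₚ B       ≈⟨ +ₚ-assoc (P′ *ₚ A′) (Q *ₚ A′) (P *ₚ B) ⟩
    P′ *ₚ A′ +ₚ (Q *ₚ A′ +ₚ P *ₚ B)       ∎
    where
    open ≈-Reasoning ≈ₚ-setoid
    E = G -ₚ G′
    B = A -ₚ A′
    P = G ^ₚ k
    P′ = G′ ^ₚ k
    Q = E ^ₚ k
    P≈P′+Q : P ≈ₚ P′ +ₚ Q
    P≈P′+Q = ≈ₚ-trans (^ₚ-cong k (f≈g+[f-g] G G′)) (frobenius p×1≡0 k p∣C G′ E)

  module _ {d m h} (G G′ : Vec Carrier d) (A A′ : Vec Carrier m)
    (agree : ∀ i → h < i → coeff (monic G ^ₚ k *ₚ monic A) i ≡ coeff (monic G′ ^ₚ k *ₚ monic A′) i) where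

    private
      E = monic G -ₚ monic G′
      B = monic A -ₚ monic A′
      u = E ^ₚ k *ₚ monic A′
      v = monic G ^ₚ k *ₚ B

    u+v≤h : Degree≤ (u +ₚ v) h
    u+v≤h i h<i = +-identityʳ-unique (coeff Y i) (coeff (u +ₚ v) i) (begin
      coeff Y i + coeff (u +ₚ v) i  ≡⟨ coeff-+ₚ Y (u +ₚ v) i ⟨
      coeff (Y +ₚ (u +ₚ v)) i       ≡⟨ coeff-≡ (power-product-split (monic G) (monic G′) (monic A) (monic A′)) i ⟨
      coeff X i                     ≡⟨ agree i h<i ⟩
      coeff Y i                     ∎)
      where
      open ≡-Reasoning
      X = monic G ^ₚ k *ₚ monic A
      Y = monic G′ ^ₚ k *ₚ monic A′

    cofactor-difference≈0 : ∀ e → Degree≤ E e → h < k ℕ.* d → k ℕ.* e ℕ.+ m < k ℕ.* d → B ≈ₚ []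
    cofactor-difference≈0 e E≤e h<kd ke+m<kd with ≈[]⊎HasDegree B
    ... | inj₁ B≈[] = B≈[]
    ... | inj₂ (b , B≤b , B_b≢0) = contradiction
          (leading-cancels v u (Degree≤-cong (+ₚ-comm u v) u+v≤h)
             (*ₚ-leading (monic G ^ₚ k) B (^ₚ-leading (monic G) k (monic-leading G)) (B≤b , refl))
             u≤ke+m (<-≤-trans h<kd (m≤m+n _ b)) (<-≤-trans ke+m<kd (m≤m+n _ b)))
          (*-≢0 (^-≢0 k 1≢0) B_b≢0)
      where
      u≤ke+m : Degree≤ u (k ℕ.* e ℕ.+ m)
      u≤ke+m = proj₁ (*ₚ-leading (E ^ₚ k) (monic A′) (^ₚ-leading E k (E≤e , refl)) (monic-leading A′))

    difference≈0 : ∀ e₁ → B ≈ₚ [] → h < k ℕ.* e₁ ℕ.+ m →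
                   (∀ i → i < e₁ → coeff (monic G) i ≡ coeff (monic G′) i) → E ≈ₚ []
    difference≈0 e₁ B≈[] h<ke₁+m low-agree with ≈[]⊎HasDegree E
    ... | inj₁ E≈[] = E≈[]
    ... | inj₂ (e , E≤e , Eₑ≢0) = contradiction
          (leading-cancels u v u+v≤h
             (*ₚ-leading (E ^ₚ k) (monic A′) (^ₚ-leading E k (E≤e , refl)) (monic-leading A′))
             (≈[]⇒Degree≤ v≈[] 0) h<ke+m (≤-<-trans z≤n h<ke+m))
          (*-≢0 (^-≢0 k Eₑ≢0) 1≢0)
      where
      v≈[] : v ≈ₚ []
      v≈[] = ≈ₚ-trans (*ₚ-congʳ (monic G ^ₚ k) B≈[]) (*ₚ-zeroʳ (monic G ^ₚ k))
      e₁≤e : e₁ ≤ e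
      e₁≤e with e₁ ≤? e
      ... | yes e₁≤e = e₁≤e
      ... | no  e₁≰e = contradiction (coeff-≡⇒coeff[f-g]≡0 (monic G) (monic G′) e (low-agree e (≰⇒> e₁≰e))) Eₑ≢0
      h<ke+m : h < k ℕ.* e ℕ.+ m
      h<ke+m = <-≤-trans h<ke₁+m (+-monoˡ-≤ m (*-monoʳ-≤ k e₁≤e))

    monic-power-cofactor-injective :
      ∀ e₁ e → h < k ℕ.* d → k ℕ.* e ℕ.+ m < k ℕ.* d → h < k ℕ.* e₁ ℕ.+ m →
      (∀ i → i < e₁ → coeff (monic G) i ≡ coeff (monic G′) i) → Degree≤ (monic G -ₚ monic G′) e → G ≡ G′
    monic-power-cofactor-injective e₁ e h<kd ke+m<kd h<ke₁+m low-agree E≤e =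
      monic-injective G G′ (coeffwise λ i → coeff[f-g]≡0⇒coeff-≡ (monic G) (monic G′) i (coeff-≡ E≈[] i))
      where
      E≈[] = difference≈0 e₁ (cofactor-difference≈0 e E≤e h<kd ke+m<kd) h<ke₁+m low-agree

module SizeOfS {q : ℕ} (K : FiniteField q) {p} (p×1≡0 : FiniteField._×1 K p ≡ FiniteField.0# K)
  {k} .{{_ : NonZero k}} (p∣C : ∀ s → 0 ℕ.< s → s ℕ.< k → p ∣ (k C s))
  {n d h} (F : Vec (FiniteField.Carrier K) n)
  (h<d : h ℕ.< d) (kd≤n : k ℕ.* d ≤ n) (n≤kd+h : n ≤ k ℕ.* d ℕ.+ h) where
  open import Data.Nat using (suc; _+_; _*_; _∸_; _^_; _<_; z≤n)
  open import Data.Nat.Properties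
  open import Data.Integer using (+_; +<+)
  open import Data.Fin as Fin using (Fin; toℕ; fromℕ<; _↑ˡ_; _↑ʳ_; splitAt; funToFin)
  open import Data.Fin.Properties using (toℕ-fromℕ<; splitAt-↑ˡ; splitAt-↑ʳ; toℕ<n)
  open import Data.List using (List; length)
  open import Data.List.Membership.Propositional using (_∈_)
  open import Data.List.Relation.Unary.All as All using (All)
  open import Data.List.Relation.Unary.Unique.Propositional using (Unique)
  open import Data.Sum using ([_,_]′)
  open import Relation.Nullary using (yes; no)
  open Counting using (Unique-length≤; funToFin-injective)
  open Arithmetic using (module CodeLength)
  open FiniteField K using (Carrier; 0#; monic; coeff; InS; _^ₚ_; _*ₚ_; _-ₚ_)
  open Polynomials K using (index; index-injective; Degree≤; monic-leading; monic-power-product-degree;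
    Leading⇒HasDegree; degree-unique; monic-coeff-≥; coeff-≡⇒coeff[f-g]≡0; Degree≤[f-g]⇒coeff-≡; 1≢0)
  open MonicPowers K p×1≡0 p∣C using (monic-power-cofactor-injective)

  m = n ∸ k * d

  open CodeLength k d m h (m≤n+o⇒m∸n≤o n (k * d) n≤kd+h) h<d

  Cofactor : Vec Carrier d → ℕ → Set
  Cofactor G m′ = Σ (Vec Carrier m′) λ A → Degree≤ (monic F -ₚ monic G ^ₚ k *ₚ monic A) h

  Member : Vec Carrier d → Set
  Member G = Cofactor G m

  InS⇒Member : ∀ {G} → InS (monic F) (+ h) k G → Member G
  InS⇒Member {G} (m′ , A , F-GᵏA≤h) = subst (Cofactor G) m′≡m (A , F-GᵏA≤h′)
    where
    F-GᵏA≤h′ : Degree≤ (monic F -ₚ monic G ^ₚ k *ₚ monic A) h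
    F-GᵏA≤h′ i h<i = F-GᵏA≤h i (+<+ h<i)
    k*d+m′≡n : k * d + m′ ≡ n
    k*d+m′≡n = sym (degree-unique (monic F) (monic G ^ₚ k *ₚ monic A)
      (Leading⇒HasDegree (monic F) (monic-leading F) 1≢0) (monic-power-product-degree k G A)
      (<-≤-trans h<k*d kd≤n) (<-≤-trans h<k*d (m≤m+n (k * d) m′)) F-GᵏA≤h′)
    m′≡m : m′ ≡ m
    m′≡m = trans (sym (m+n∸m≡n (k * d) m′)) (cong (_∸ k * d) k*d+m′≡n)

  position : Fin (e₁ + e₂) → ℕ
  position j = [ toℕ , (λ j → suc t + toℕ j) ]′ (splitAt e₁ j)

  position-low : ∀ {i} (i<e₁ : i < e₁) → position (fromℕ< i<e₁ ↑ˡ e₂) ≡ i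
  position-low i<e₁ rewrite splitAt-↑ˡ e₁ (fromℕ< i<e₁) e₂ = toℕ-fromℕ< i<e₁

  position-high : ∀ {i} → t < i → i < d → Σ (Fin (e₁ + e₂)) λ j → position j ≡ i
  position-high {i} t<i i<d = e₁ ↑ʳ fromℕ< offset<e₂ , eq
    where
    offset<e₂ : i ∸ suc t < e₂
    offset<e₂ = subst (i ∸ suc t <_) (trans (cong (_∸ suc t) (sym 1+t+e₂≡d)) (m+n∸m≡n (suc t) e₂)) (∸-monoˡ-< i<d t<i)
    eq : position (e₁ ↑ʳ fromℕ< offset<e₂) ≡ i
    eq rewrite splitAt-↑ʳ e₁ e₂ (fromℕ< offset<e₂) | toℕ-fromℕ< offset<e₂ = m+[n∸m]≡n t<i

  digits : Vec Carrier d → Fin (e₁ + e₂) → Fin q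
  digits G j = index (coeff (monic G) (position j))

  code : Vec Carrier d → Fin (q ^ (e₁ + e₂))
  code G = funToFin (digits G)

  code-injective : ∀ {G G′} → Member G → Member G′ → code G ≡ code G′ → G ≡ G′
  code-injective {G} {G′} (A , F-GᵏA≤h) (A′ , F-G′ᵏA′≤h) same-code =
    monic-power-cofactor-injective G G′ A A′ agree e₁ t h<k*d k*t+m<k*d h<k*e₁+m low E≤t
    where
    same : ∀ j → coeff (monic G) (position j) ≡ coeff (monic G′) (position j)
    same j = index-injective (funToFin-injective (digits G) (digits G′) same-code j)
    low : ∀ i → i < e₁ → coeff (monic G) i ≡ coeff (monic G′) i
    low i i<e₁ = subst (λ i → coeff (monic G) i ≡ coeff (monic G′) i) (position-low i<e₁) (same (fromℕ< i<e₁ ↑ˡ e₂))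
    high : ∀ i → t < i → coeff (monic G) i ≡ coeff (monic G′) i
    high i t<i with i <? d
    ... | yes i<d = let j , pⱼ≡i = position-high t<i i<d in
                    subst (λ i → coeff (monic G) i ≡ coeff (monic G′) i) pⱼ≡i (same j)
    ... | no  i≮d = monic-coeff-≥ G G′ i (≮⇒≥ i≮d)
    E≤t : Degree≤ (monic G -ₚ monic G′) t
    E≤t i t<i = coeff-≡⇒coeff[f-g]≡0 (monic G) (monic G′) i (high i t<i)
    agree : ∀ i → h < i → coeff (monic G ^ₚ k *ₚ monic A) i ≡ coeff (monic G′ ^ₚ k *ₚ monic A′) i
    agree i h<i = trans (sym (Degree≤[f-g]⇒coeff-≡ (monic F) _ F-GᵏA≤h i h<i))
                        (Degree≤[f-g]⇒coeff-≡ (monic F) _ F-G′ᵏA′≤h i h<i)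

  size-bound : (L : List (Vec Carrier d)) → Unique L → All (InS (monic F) (+ h) k) L → length L ^ k ≤ q ^ (h + k)
  size-bound L unique members = begin
    length L ^ k                ≤⟨ ^-monoˡ-≤ k (Unique-length≤ unique code code-injective′) ⟩
    (q ^ (e₁ + e₂)) ^ k         ≡⟨ ^-*-assoc q (e₁ + e₂) k ⟩
    q ^ ((e₁ + e₂) * k)         ≤⟨ ^-monoʳ-≤ q {{ℕ.>-nonZero (≤-<-trans z≤n (toℕ<n (index 0#)))}} code-length ⟩
    q ^ (h + k)                 ∎
    where
    open ≤-Reasoning
    code-injective′ : ∀ {G G′} → G ∈ L → G′ ∈ L → code G ≡ code G′ → G ≡ G′
    code-injective′ G∈L G′∈L =
      code-injective (InS⇒Member (All.lookup members G∈L)) (InS⇒Member (All.lookup members G′∈L))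

open import Data.Integer using (ℤ; +_; _<_; _-_; _*_; _+_) renaming (_≤_ to _≤ℤ_)
open import Data.List using (List; length)
open import Data.List.Relation.Unary.All using (All)
open import Data.List.Relation.Unary.Unique.Propositional using (Unique)
import Data.Integer.Properties as ℤ
open IntegerArithmetic using (excess-nonneg)
open SizeOfS using (size-bound)

-- Matching on 2 ≤ k just exposes k as
-- a successor, so that NonZero k is found by instance search.
lemma5p2 : (q : ℕ) → IsPrimePower q → (K : FiniteField q) → (p : ℕ) → HasChar K p →
           (k n : ℕ) → 2 ≤ k → (h : ℤ) →
           (F : Vec (FiniteField.Carrier K) n) →
           LeastNonDiv p k k →
           (d : ℕ) → h < + d → (+ n - h) ≤ℤ (+ k * + d) → (+ k * + d) ≤ℤ + n →
           (L : List (Vec (FiniteField.Carrier K) d)) → Unique L →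
           All (λ G → FiniteField.InS K (FiniteField.monic K F) h k G) L →
           RootBound q k (length L) (h + + k)
lemma5p2 q _ K p (_ , p×1≡0) k n (ℕ.s≤s _) h F (_ , _ , p∣C) d h<d n-h≤kd kd≤n L unique members
  with + k * + d | sym (ℤ.pos-* k d)
... | _ | refl with excess-nonneg h n-h≤kd kd≤n
...   | h′ , refl , n≤kd+h′ =
  size-bound K p×1≡0 p∣C F (ℤ.drop‿+<+ h<d) (ℤ.drop‿+≤+ kd≤n) n≤kd+h′ L unique members
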